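{- Let $\mathcal M$ be a locally finite minion and let $\mathcal N$ be an $l$-representable minion. Then $\mathcal N^{\mathcal M}$ is $l$-representable.
   Context: Write $n=\{0,\dots,n-1\}$. A minion consists of sets $\mathcal M_k$ ($k\ge1$) and maps $f\mapsto f\alpha$ for each map $\alpha:k\to m$, with $f\,\mathrm{id}=f$, $(f\alpha)\beta=f(\beta\circ\alpha)$; homomorphisms are arity-wise maps commuting with these; products are arity-wise. Locally finite: every $\mathcal M_k$ finite. $\mathcal O(l,k)_m$ is the set of functions $l^m\to k$ with $(f\alpha)(x_0,\dots)=f(x_{\alpha(0)},\dots)$; a minion is $l$-representable if for some $k$ it admits an arity-wise injective homomorphism into $\mathcal O(l,k)$. The projection minion $\mathcal P$ has $\mathcal P_k=k$, $i\alpha=\alpha(i)$; $(\mathcal P^n)_k$ is identified with maps $n\to k$. The exponential $\mathcal N^{\mathcal M}$ has $(\mathcal N^{\mathcal M})_n$ the set of homomorphisms $H:\mathcal P^n\times\mathcal M\to\mathcal N$, and $\alpha:n\to n'$ sends $H$ to $(\beta,m)\mapsto H(\beta\circ\alpha,m)$. -}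

module Defs where

open import Data.Nat using (ℕ; suc)
open import Data.Fin using (Fin)
open import Data.Vec using (Vec; tabulate; lookup)
open import Data.Vec.Properties using (tabulate∘lookup; lookup∘tabulate; tabulate-cong)
open import Data.Product using (Σ; Σ-syntax; _×_; _,_; proj₁; proj₂)
open import Relation.Binary using (Setoid; IsEquivalence)
open import Relation.Binary.PropositionalEquality as ≡
  using (_≡_; _≗_; refl)
open import Function using (_∘_; id)
open import Function.Bundles using (Inverse)

-- Convention: arities are positive.  We index by ℕ, and the index n stands
-- for the arity n+1, i.e. for the finite set  [ n ] = Fin (suc n)  = {0,…,n}.
[_] : ℕ → Set
[ n ] = Fin (suc n)

-- A minion, with each arity-wise set given as a setoid (sets up to an
-- equivalence, the standard constructive rendering of sets whose elements
-- may be functions).  El n is the set M_{n+1}; act f α is  fα.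
record Minion : Set₁ where
  field
    El       : ℕ → Set
    _≈_      : ∀ {n} → El n → El n → Set
    isEquiv  : ∀ {n} → IsEquivalence (_≈_ {n})
    act      : ∀ {n m} → El n → ([ n ] → [ m ]) → El m
    act-cong : ∀ {n m} {f g : El n} {α β : [ n ] → [ m ]} →
               f ≈ g → α ≗ β → act f α ≈ act g β
    act-id   : ∀ {n} (f : El n) → act f id ≈ f
    act-comp : ∀ {n m p} (f : El n) (α : [ n ] → [ m ]) (β : [ m ] → [ p ]) →
               act (act f α) β ≈ act f (β ∘ α)

  setoid : ℕ → Setoid _ _
  setoid n = record { Carrier = El n ; _≈_ = _≈_ ; isEquivalence = isEquiv }

open Minion public using (El; act)

record Hom (M N : Minion) : Set where
  field
    fun  : ∀ {n} → El M n → El N n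
    cong : ∀ {n} {x y : El M n} → Minion._≈_ M x y → Minion._≈_ N (fun x) (fun y)
    comm : ∀ {n m} (f : El M n) (α : [ n ] → [ m ]) →
           Minion._≈_ N (fun (act M f α)) (act N (fun f) α)

open Hom public

Injective : ∀ {M N} → Hom M N → Set
Injective {M} {N} h = ∀ {n} (x y : El M n) →
  Minion._≈_ N (fun h x) (fun h y) → Minion._≈_ M x y

LocallyFinite : Minion → Set
LocallyFinite M = ∀ n → Σ[ c ∈ ℕ ] Inverse (Minion.setoid M n) (≡.setoid (Fin c))

_⊗_ : Minion → Minion → Minion
M ⊗ N = record
  { El = λ n → El M n × El N n
  ; _≈_ = λ p q → Minion._≈_ M (proj₁ p) (proj₁ q) × Minion._≈_ N (proj₂ p) (proj₂ q)
  ; isEquiv = record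
    { refl = MM.refl , NN.refl
    ; sym = λ (a , b) → MM.sym a , NN.sym b
    ; trans = λ (a , b) (c , d) → MM.trans a c , NN.trans b d }
  ; act = λ (x , y) α → act M x α , act N y α
  ; act-cong = λ (a , b) e → Minion.act-cong M a e , Minion.act-cong N b e
  ; act-id = λ (x , y) → Minion.act-id M x , Minion.act-id N y
  ; act-comp = λ (x , y) α β → Minion.act-comp M x α β , Minion.act-comp N y α β
  }
  where
  module MM {n} = IsEquivalence (Minion.isEquiv M {n})
  module NN {n} = IsEquivalence (Minion.isEquiv N {n})

-- The power P^n of the projection minion, for positive n (index n ↦ arity n+1):
-- (P^n)_k = maps [n] → [k], and α sends β to α ∘ β.
Pow : ℕ → Minion
Pow n = record
  { El = λ k → [ n ] → [ k ]
  ; _≈_ = _≗_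
  ; isEquiv = record { refl = λ _ → refl ; sym = λ p i → ≡.sym (p i)
                     ; trans = λ p q i → ≡.trans (p i) (q i) }
  ; act = λ β α → α ∘ β
  ; act-cong = λ {_} {_} {f} {g} {α} {β} p q i → ≡.trans (≡.cong α (p i)) (q (g i))
  ; act-id = λ _ _ → refl
  ; act-comp = λ _ _ _ _ → refl
  }

_^_ : Minion → Minion → Minion
N ^ M = record
  { El = λ n → Hom (Pow n ⊗ M) N
  ; _≈_ = λ H H' → ∀ {k} (x : El (Pow _ ⊗ M) k) → Minion._≈_ N (fun H x) (fun H' x)
  ; isEquiv = record { refl = λ _ → N.refl ; sym = λ p x → N.sym (p x)
                     ; trans = λ p q x → N.trans (p x) (q x) }
  ; act = λ H α → record
      { fun = λ (β , m) → fun H (β ∘ α , m)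
      ; cong = λ (p , q) → cong H ((λ i → p (α i)) , q)
      ; comm = λ (β , m) γ → comm H (β ∘ α , m) γ }
  ; act-cong = λ {_} {_} {H} {H'} {α} {α'} p q (β , m) →
      N.trans (p (β ∘ α , m)) (cong H' ((λ i → ≡.cong β (q i)) , M.refl))
  ; act-id = λ _ _ → N.refl
  ; act-comp = λ _ _ _ _ → N.refl
  }
  where
  module N {n} = IsEquivalence (Minion.isEquiv N {n})
  module M {n} = IsEquivalence (Minion.isEquiv M {n})

O : ℕ → ℕ → Minion
O l k = record
  { El = λ m → Vec (Fin l) (suc m) → Fin k
  ; _≈_ = λ f g → ∀ x → f x ≡ g x
  ; isEquiv = record { refl = λ _ → refl ; sym = λ p x → ≡.sym (p x)
                     ; trans = λ p q x → ≡.trans (p x) (q x) }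
  ; act = λ f α x → f (tabulate (λ i → lookup x (α i)))
  ; act-cong = λ {_} {_} {f} {g} p q x →
      ≡.trans (p _) (≡.cong g (tabulate-cong (λ i → ≡.cong (lookup x) (q i))))
  ; act-id = λ f x → ≡.cong f (tabulate∘lookup x)
  ; act-comp = λ f α β x → ≡.cong f (tabulate-cong (λ i →
      lookup∘tabulate (λ j → lookup x (β j)) (α i)))
  }

Representable : ℕ → Minion → Set
Representable l M = Σ[ k ∈ ℕ ] Σ[ h ∈ Hom M (O l k) ] Injective h

{-# OPTIONS --safe #-}
module Submission where

open import Defs
open import Data.Nat using (ℕ; zero; suc)
import Data.Nat as ℕ
open import Data.Fin using (Fin; funToFin; finToFun; combine)
import Data.Fin as Fin
open import Data.Fin.Properties using (finToFun-funToFin)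
open import Data.Vec using (Vec; tabulate; lookup; _∷_)
open import Data.Vec.Properties using (tabulate∘lookup; lookup∘tabulate; tabulate-cong)
open import Data.Product using (_,_; proj₁; proj₂)
open import Relation.Binary using (IsEquivalence)
open import Relation.Binary.PropositionalEquality as ≡ using (_≡_; _≗_; refl)
open import Function using (_∘_; id)
open import Function.Bundles using (Inverse)

-- For l > 0 a homomorphism Q → O(l,k) amounts to a map φ : Q_l → k, sending q
-- to y ↦ φ(q y), and it is injective exactly when φ separates elements through
-- all their l-ary minors.  If φ separates N, then H ↦ (φ (H (id , m)))_{m ∈ M_l}
-- separates N^M: a value H(β, m) is recovered from its minors
-- H(β, m) γ ≈ H(γ β, m γ), and m γ ranges over the finite set M_l, so this
-- functional takes values in the finite set k^{M_l}.  For l = 0 everything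
-- collapses: 0-representable minions are trivial, and so is N^M.

funToFin-cong : ∀ {m n} {f g : Fin m → Fin n} → f ≗ g → funToFin f ≡ funToFin g
funToFin-cong {zero}  f≗g = refl
funToFin-cong {suc m} f≗g = ≡.cong₂ combine (f≗g Fin.zero) (funToFin-cong (f≗g ∘ Fin.suc))

funToFin-injective : ∀ {m n} {f g : Fin m → Fin n} → funToFin f ≡ funToFin g → f ≗ g
funToFin-injective {f = f} {g} eq j = begin
  f j                     ≡⟨ ≡.sym (finToFun-funToFin f j) ⟩
  finToFun (funToFin f) j ≡⟨ ≡.cong (λ z → finToFun z j) eq ⟩
  finToFun (funToFin g) j ≡⟨ finToFun-funToFin g j ⟩
  g j                     ∎
  where open ≡.≡-Reasoning

Trivial : Minion → Set
Trivial Q = ∀ {n} (a b : El Q n) → Minion._≈_ Q a b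

representable-zero⇒trivial : ∀ {Q} → Representable 0 Q → Trivial Q
representable-zero⇒trivial (_ , h , h-inj) a b = h-inj a b λ { (() ∷ _) }

trivial⇒representable-zero : ∀ {Q} → Trivial Q → Representable 0 Q
trivial⇒representable-zero triv =
  0 , record { fun = λ _ → λ { (() ∷ _) } ; cong = λ _ → λ { (() ∷ _) } ; comm = λ _ _ → λ { (() ∷ _) } }
    , λ a b _ → triv a b

^-trivial : ∀ {M N} → Trivial N → Trivial (N ^ M)
^-trivial triv H H' x = triv (fun H x) (fun H' x)

Separating : (Q : Minion) {l k : ℕ} → (El Q l → Fin k) → Set
Separating Q {l} φ = ∀ {n} (a b : El Q n) →
  (∀ (γ : [ n ] → [ l ]) → φ (act Q a γ) ≡ φ (act Q b γ)) → Minion._≈_ Q a b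

identityTuple : ∀ {l} → Vec (Fin (suc l)) (suc l)
identityTuple = tabulate id

O-minor-identityTuple : ∀ {l k m} (f : El (O (suc l) k) m) (y : Vec (Fin (suc l)) (suc m)) →
                        act (O (suc l) k) f (lookup y) identityTuple ≡ f y
O-minor-identityTuple f y = ≡.cong f (begin
  tabulate (lookup identityTuple ∘ lookup y) ≡⟨ tabulate-cong (lookup∘tabulate id ∘ lookup y) ⟩
  tabulate (lookup y)                        ≡⟨ tabulate∘lookup y ⟩
  y                                          ∎)
  where open ≡.≡-Reasoning

hom-into-O-via-minors : ∀ {Q l k n} (h : Hom Q (O (suc l) k)) (a : El Q n) (y : Vec (Fin (suc l)) (suc n)) →
                        fun h a y ≡ fun h (act Q a (lookup y)) identityTuple
hom-into-O-via-minors h a y =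
  ≡.trans (≡.sym (O-minor-identityTuple (fun h a) y)) (≡.sym (comm h a (lookup y) identityTuple))

injective⇒separating : ∀ {Q l k} (h : Hom Q (O (suc l) k)) → Injective h →
                       Separating Q (λ a → fun h a identityTuple)
injective⇒separating h h-inj a b same = h-inj a b λ y →
  ≡.trans (hom-into-O-via-minors h a y)
    (≡.trans (same (lookup y)) (≡.sym (hom-into-O-via-minors h b y)))

module _ (Q : Minion) {l k : ℕ} (φ : El Q l → Fin k)
         (φ-cong : ∀ {a b} → Minion._≈_ Q a b → φ a ≡ φ b) where
  open Minion Q using (act-cong; act-comp)
  module ≈ {n} = IsEquivalence (Minion.isEquiv Q {n})

  functionalHom : Hom Q (O (suc l) k)
  functionalHom = record
    { fun  = λ a y → φ (act Q a (lookup y))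
    ; cong = λ a≈b y → φ-cong (act-cong a≈b λ _ → refl)
    ; comm = λ a α y → φ-cong (≈.trans (act-comp a α (lookup y))
                                (act-cong ≈.refl (≡.sym ∘ lookup∘tabulate (lookup y ∘ α))))
    }

  separating⇒representable : Separating Q φ → Representable (suc l) Q
  separating⇒representable sep = k , functionalHom , λ a b h≈ → sep a b λ γ →
    let γ≗lookup∘tabulate = ≡.sym ∘ lookup∘tabulate γ in
    ≡.trans (φ-cong (act-cong ≈.refl γ≗lookup∘tabulate))
      (≡.trans (h≈ (tabulate γ)) (φ-cong (act-cong ≈.refl (≡.sym ∘ γ≗lookup∘tabulate))))

module Exponential (M N : Minion) {l c k : ℕ} (enum : Inverse (Minion.setoid M l) (≡.setoid (Fin c)))
         (φ : El N l → Fin k) where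
  open Inverse enum using (to; from)

  exponentialFunctional : El (N ^ M) l → Fin (k ℕ.^ c)
  exponentialFunctional H = funToFin λ j → φ (fun H (id , from j))

  module _ (φ-cong : ∀ {a b} → Minion._≈_ N a b → φ a ≡ φ b) where
    module ≈ᴺ {n} = IsEquivalence (Minion.isEquiv N {n})
    module ≈ᴹ {n} = IsEquivalence (Minion.isEquiv M {n})

    exponentialFunctional-cong : ∀ {H H' : El (N ^ M) l} → Minion._≈_ (N ^ M) H H' →
                                 exponentialFunctional H ≡ exponentialFunctional H'
    exponentialFunctional-cong H≈H' = funToFin-cong λ j → φ-cong (H≈H' (id , from j))

    φ-minor-of-value : ∀ {n p} (H : El (N ^ M) n) (β : [ n ] → [ p ]) (m : El M p) (γ : [ p ] → [ l ]) →
                       φ (act N (fun H (β , m)) γ) ≡ φ (fun H (γ ∘ β , from (to (act M m γ))))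
    φ-minor-of-value H β m γ = φ-cong (≈ᴺ.trans (≈ᴺ.sym (comm H (β , m) γ))
      (Hom.cong H ((λ _ → refl) , ≈ᴹ.sym (Inverse.inverseʳ enum refl))))

    ^-separating : Separating N φ → Separating (N ^ M) exponentialFunctional
    ^-separating sep H H' same (β , m) = sep (fun H (β , m)) (fun H' (β , m)) λ γ →
      ≡.trans (φ-minor-of-value H β m γ)
        (≡.trans (funToFin-injective (same (γ ∘ β)) (to (act M m γ)))
          (≡.sym (φ-minor-of-value H' β m γ)))

proposition7p4p1 : (l : ℕ) (M N : Minion) →
    LocallyFinite M → Representable l N → Representable l (N ^ M)
proposition7p4p1 zero M N _ rep =
  trivial⇒representable-zero (^-trivial {M} (representable-zero⇒trivial rep))
proposition7p4p1 (suc l) M N finite (k , h , h-inj) =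
  separating⇒representable (N ^ M) exponentialFunctional
    (λ {H} {H'} → exponentialFunctional-cong φ-cong {H} {H'})
    (^-separating φ-cong (injective⇒separating h h-inj))
  where
  φ : El N l → Fin k
  φ a = fun h a identityTuple
  φ-cong : ∀ {a b} → Minion._≈_ N a b → φ a ≡ φ b
  φ-cong a≈b = Hom.cong h a≈b identityTuple
  open Exponential M N (proj₂ (finite l)) φ
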